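{- Let $\mathbf{A}$ be a distributive nearlattice. Then the following are equivalent: (1) $\mathbf{A}$ is Stone; (2) every element of $\mathrm{R}(A)=\{a^{\top}\colon a\in A\}$ has a complement in the lattice $\mathrm{Fi}(A)$, i.e. for each $a\in A$ there is a filter $F$ with $a^{\top}\cap F=\{1\}$ and $a^{\top}\veebar F=A$.
   Context: A distributive nearlattice is a join-semilattice $\langle A,\vee,1\rangle$ with greatest element $1$ in which every principal filter $[a)=\{x\in A\colon a\le x\}$ is a bounded distributive lattice. A filter of $A$ is a subset containing $1$, upward closed, and closed under those binary meets that exist; $\mathrm{Fi}(A)$ is the lattice of filters ordered by inclusion, with meet $\cap$, join $F\veebar G$ the smallest filter containing $F\cup G$, least element $\{1\}$ and greatest element $A$. For $a\in A$, $a^{\top}=\{x\in A\colon x\vee a=1\}$ and $a^{\top\top}=\{y\in A\colon y\vee x=1\text{ for all }x\in a^{\top}\}$. $\mathbf{A}$ is Stone if $a^{\top}\veebar a^{\top\top}=A$ for every $a\in A$. -}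

module Defs where

open import Level using (0ℓ)
open import Data.Product using (Σ; _×_)
open import Relation.Binary.PropositionalEquality using (_≡_)
open import Relation.Unary using (Pred; _⊆_)

-- A distributive nearlattice: a join-semilattice ⟨A, ∨, 1⟩ with greatest
-- element 1 in which every principal filter [a) = {x | a ≤ x} is a bounded
-- distributive lattice (bottom a, top 1).  The order is x ≤ y iff x ∨ y ≡ y.
record DistNearlattice : Set₁ where
  infixr 6 _∨_
  infix 4 _≤_
  field
    Carrier : Set
    _∨_     : Carrier → Carrier → Carrier
    𝟏       : Carrier
    ∨-assoc : ∀ x y z → (x ∨ y) ∨ z ≡ x ∨ (y ∨ z)
    ∨-comm  : ∀ x y → x ∨ y ≡ y ∨ x
    ∨-idem  : ∀ x → x ∨ x ≡ x
    ∨-𝟏     : ∀ x → x ∨ 𝟏 ≡ 𝟏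

  _≤_ : Carrier → Carrier → Set
  x ≤ y = x ∨ y ≡ y

  field
    meetIn      : (a x y : Carrier) → a ≤ x → a ≤ y → Carrier
    meetIn-≥a   : ∀ a x y (p : a ≤ x) (q : a ≤ y) → a ≤ meetIn a x y p q
    meetIn-≤ˡ   : ∀ a x y (p : a ≤ x) (q : a ≤ y) → meetIn a x y p q ≤ x
    meetIn-≤ʳ   : ∀ a x y (p : a ≤ x) (q : a ≤ y) → meetIn a x y p q ≤ y
    meetIn-glb  : ∀ a x y (p : a ≤ x) (q : a ≤ y) (z : Carrier) →
                  a ≤ z → z ≤ x → z ≤ y → z ≤ meetIn a x y p q
    meetIn-distrib : ∀ a x y z (px : a ≤ x) (py : a ≤ y) (pz : a ≤ z)
                     (pyz : a ≤ y ∨ z) →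
                     meetIn a x (y ∨ z) px pyz
                       ≡ meetIn a x y px py ∨ meetIn a x z px pz

module _ (A : DistNearlattice) where
  open DistNearlattice A

  IsMeet : Carrier → Carrier → Carrier → Set
  IsMeet x y m = (m ≤ x) × (m ≤ y) × (∀ z → z ≤ x → z ≤ y → z ≤ m)

  record IsFilter (F : Pred Carrier 0ℓ) : Set where
    field
      has-𝟏   : F 𝟏
      up      : ∀ {x y} → x ≤ y → F x → F y
      meet-cl : ∀ {x y m} → IsMeet x y m → F x → F y → F m

  MeetIsBottom : Pred Carrier 0ℓ → Pred Carrier 0ℓ → Set
  MeetIsBottom F G = ∀ x → F x → G x → x ≡ 𝟏

  -- F ⊻ G = A, where F ⊻ G is the smallest filter containing F ∪ G
  -- (i.e. the intersection of all filters containing F and G)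
  JoinIsTop : Pred Carrier 0ℓ → Pred Carrier 0ℓ → Set₁
  JoinIsTop F G = ∀ (H : Pred Carrier 0ℓ) → IsFilter H → F ⊆ H → G ⊆ H →
                  ∀ x → H x

  _⊤ : Carrier → Pred Carrier 0ℓ
  (a ⊤) x = x ∨ a ≡ 𝟏

  _⊤⊤ : Carrier → Pred Carrier 0ℓ
  (a ⊤⊤) y = ∀ x → (a ⊤) x → y ∨ x ≡ 𝟏

  IsStone : Set₁
  IsStone = ∀ a → JoinIsTop (a ⊤) (a ⊤⊤)

  RComplemented : Set₁
  RComplemented = ∀ a → Σ (Pred Carrier 0ℓ) λ F →
                    IsFilter F × MeetIsBottom (a ⊤) F × JoinIsTop (a ⊤) F

module Submission where

-- The filter a^⊤⊤ is always disjoint from a^⊤ (x ∨ x = x), and it is the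
-- largest such filter: if F ∩ a^⊤ = {1} then for y ∈ F and x ∈ a^⊤ the element
-- y ∨ x lies in both, so y ∨ x = 1.  Hence a^⊤ has a complement in Fi(A) iff
-- a^⊤⊤ is one, i.e. iff a^⊤ ⊻ a^⊤⊤ = A.  That a^⊤⊤ is closed under existing
-- meets m = y ∧ z uses distributivity of the principal filter [m):
-- (y ∨ x) ∧ (z ∨ x) = (y ∧ z) ∨ x = m ∨ x there.

open import Defs
open import Function.Bundles using (_⇔_; mk⇔)
open import Data.Product using (_,_)
open import Relation.Binary.PropositionalEquality
open import Relation.Unary using (Pred; _⊆_)
open import Level using (0ℓ)

JoinIsTop-monoʳ : ∀ (A : DistNearlattice) {F G G′ : Pred (DistNearlattice.Carrier A) 0ℓ} →
                  G ⊆ G′ → JoinIsTop A F G → JoinIsTop A F G′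
JoinIsTop-monoʳ A G⊆G′ F⊻G=A H isFilterH F⊆H G′⊆H =
  F⊻G=A H isFilterH F⊆H (λ Gx → G′⊆H (G⊆G′ Gx))

module NearlatticeProperties (A : DistNearlattice) where
  open DistNearlattice A
  open ≡-Reasoning

  𝟏-∨ : ∀ x → 𝟏 ∨ x ≡ 𝟏
  𝟏-∨ x = trans (∨-comm 𝟏 x) (∨-𝟏 x)

  ∨-≡𝟏-weaken : ∀ w {x y} → x ∨ y ≡ 𝟏 → (w ∨ x) ∨ y ≡ 𝟏
  ∨-≡𝟏-weaken w {x} {y} x∨y=𝟏 = begin
    (w ∨ x) ∨ y ≡⟨ ∨-assoc w x y ⟩
    w ∨ (x ∨ y) ≡⟨ cong (w ∨_) x∨y=𝟏 ⟩
    w ∨ 𝟏       ≡⟨ ∨-𝟏 w ⟩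
    𝟏           ∎

  ≤-reflexive : ∀ {x y} → x ≡ y → x ≤ y
  ≤-reflexive {x} refl = ∨-idem x

  ≤-trans : ∀ {x y z} → x ≤ y → y ≤ z → x ≤ z
  ≤-trans {x} {y} {z} x≤y y≤z = begin
    x ∨ z       ≡⟨ cong (x ∨_) (sym y≤z) ⟩
    x ∨ (y ∨ z) ≡⟨ sym (∨-assoc x y z) ⟩
    (x ∨ y) ∨ z ≡⟨ cong (_∨ z) x≤y ⟩
    y ∨ z       ≡⟨ y≤z ⟩
    z           ∎

  x≤x∨y : ∀ x y → x ≤ x ∨ y
  x≤x∨y x y = trans (sym (∨-assoc x x y)) (cong (_∨ y) (∨-idem x))

  y≤x∨y : ∀ x y → y ≤ x ∨ y
  y≤x∨y x y = subst (y ≤_) (∨-comm y x) (x≤x∨y y x)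

  ∨-lub : ∀ {x y z} → x ≤ z → y ≤ z → x ∨ y ≤ z
  ∨-lub {x} {y} {z} x≤z y≤z = begin
    (x ∨ y) ∨ z ≡⟨ ∨-assoc x y z ⟩
    x ∨ (y ∨ z) ≡⟨ cong (x ∨_) y≤z ⟩
    x ∨ z       ≡⟨ x≤z ⟩
    z           ∎

  𝟏≤⇒≡𝟏 : ∀ {x} → 𝟏 ≤ x → x ≡ 𝟏
  𝟏≤⇒≡𝟏 {x} 𝟏≤x = trans (sym 𝟏≤x) (𝟏-∨ x)

  meetIn-comm-≤ : ∀ {m x y} (p : m ≤ x) (q : m ≤ y) →
                  meetIn m x y p q ≤ meetIn m y x q p
  meetIn-comm-≤ {m} {x} {y} p q =
    meetIn-glb m y x q p _ (meetIn-≥a m x y p q) (meetIn-≤ʳ m x y p q) (meetIn-≤ˡ m x y p q)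

  ∨-distribˡ-meetIn-≤ : ∀ {m u y z} (mu : m ≤ u) (my : m ≤ y) (mz : m ≤ z)
                        (p : m ≤ u ∨ y) (q : m ≤ u ∨ z) →
                        meetIn m (u ∨ y) (u ∨ z) p q ≤ u ∨ meetIn m y z my mz
  ∨-distribˡ-meetIn-≤ {m} {u} {y} {z} mu my mz p q =
    subst (_≤ u ∨ y∧z) (sym (meetIn-distrib m (u ∨ y) u z p mu mz q))
      (∨-lub (≤-trans (meetIn-≤ʳ m (u ∨ y) u p mu) (x≤x∨y u y∧z))
             (≤-trans (meetIn-comm-≤ p mz) z∧[u∨y]≤u∨y∧z))
    where
    y∧z : Carrier
    y∧z = meetIn m y z my mz
    z∧[u∨y]≤u∨y∧z : meetIn m z (u ∨ y) mz p ≤ u ∨ y∧z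
    z∧[u∨y]≤u∨y∧z =
      subst (_≤ u ∨ y∧z) (sym (meetIn-distrib m z u y mz mu my p))
        (∨-lub (≤-trans (meetIn-≤ʳ m z u mz mu) (x≤x∨y u y∧z))
               (≤-trans (meetIn-comm-≤ mz my) (y≤x∨y u y∧z)))

  IsMeet-∨-≡𝟏 : ∀ {y z m x} → IsMeet A y z m → y ∨ x ≡ 𝟏 → z ∨ x ≡ 𝟏 → m ∨ x ≡ 𝟏
  IsMeet-∨-≡𝟏 {y} {z} {m} {x} (m≤y , m≤z , m-glb) y∨x=𝟏 z∨x=𝟏 =
    𝟏≤⇒≡𝟏 (≤-trans 𝟏≤[u∨y]∧[u∨z] (≤-trans [u∨y]∧[u∨z]≤u∨y∧z u∨y∧z≤u))
    where
    u : Carrier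
    u = m ∨ x
    m≤u : m ≤ u
    m≤u = x≤x∨y m x
    u∨y=𝟏 : u ∨ y ≡ 𝟏
    u∨y=𝟏 = ∨-≡𝟏-weaken m (trans (∨-comm x y) y∨x=𝟏)
    u∨z=𝟏 : u ∨ z ≡ 𝟏
    u∨z=𝟏 = ∨-≡𝟏-weaken m (trans (∨-comm x z) z∨x=𝟏)
    p : m ≤ u ∨ y
    p = ≤-trans m≤u (x≤x∨y u y)
    q : m ≤ u ∨ z
    q = ≤-trans m≤u (x≤x∨y u z)
    𝟏≤[u∨y]∧[u∨z] : 𝟏 ≤ meetIn m (u ∨ y) (u ∨ z) p q
    𝟏≤[u∨y]∧[u∨z] = meetIn-glb m (u ∨ y) (u ∨ z) p q 𝟏 (∨-𝟏 m)
                      (≤-reflexive (sym u∨y=𝟏)) (≤-reflexive (sym u∨z=𝟏))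
    [u∨y]∧[u∨z]≤u∨y∧z : meetIn m (u ∨ y) (u ∨ z) p q ≤ u ∨ meetIn m y z m≤y m≤z
    [u∨y]∧[u∨z]≤u∨y∧z = ∨-distribˡ-meetIn-≤ m≤u m≤y m≤z p q
    y∧z≤m : meetIn m y z m≤y m≤z ≤ m
    y∧z≤m = m-glb _ (meetIn-≤ˡ m y z m≤y m≤z) (meetIn-≤ʳ m y z m≤y m≤z)
    u∨y∧z≤u : u ∨ meetIn m y z m≤y m≤z ≤ u
    u∨y∧z≤u = ∨-lub (≤-reflexive refl) (≤-trans y∧z≤m m≤u)

  ⊤⊤-isFilter : ∀ a → IsFilter A (_⊤⊤ A a)
  ⊤⊤-isFilter a = record
    { has-𝟏   = λ x _ → 𝟏-∨ x
    ; up      = λ {y} {z} y≤z y∈ x x∈ →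
                  subst (λ w → w ∨ x ≡ 𝟏) (trans (∨-comm z y) y≤z)
                        (∨-≡𝟏-weaken z (y∈ x x∈))
    ; meet-cl = λ isMeet y∈ z∈ x x∈ → IsMeet-∨-≡𝟏 isMeet (y∈ x x∈) (z∈ x x∈)
    }

  ⊤-⊤⊤-disjoint : ∀ a → MeetIsBottom A (_⊤ A a) (_⊤⊤ A a)
  ⊤-⊤⊤-disjoint a x x∈⊤ x∈⊤⊤ = trans (sym (∨-idem x)) (x∈⊤⊤ x x∈⊤)

  disjoint-filter⊆⊤⊤ : ∀ {a F} → IsFilter A F → MeetIsBottom A (_⊤ A a) F →
                       F ⊆ _⊤⊤ A a
  disjoint-filter⊆⊤⊤ isFilterF disjoint {y} y∈F x x∈⊤ =
    disjoint (y ∨ x) (∨-≡𝟏-weaken y x∈⊤) (IsFilter.up isFilterF (x≤x∨y y x) y∈F)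

theorem4p5 : (A : DistNearlattice) → IsStone A ⇔ RComplemented A
theorem4p5 A = mk⇔ stone⇒complemented complemented⇒stone
  where
  open NearlatticeProperties A
  stone⇒complemented : IsStone A → RComplemented A
  stone⇒complemented stone a = _⊤⊤ A a , ⊤⊤-isFilter a , ⊤-⊤⊤-disjoint a , stone a
  complemented⇒stone : RComplemented A → IsStone A
  complemented⇒stone complemented a =
    let (F , isFilterF , disjoint , a⊤⊻F=A) = complemented a
    in JoinIsTop-monoʳ A (disjoint-filter⊆⊤⊤ isFilterF disjoint) a⊤⊻F=A
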